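{- Let $a,b$ be non-negative integers with $a+b$ even, and let \begin{align*} C=&\sum_{\substack{l+m=b-1\\ l,m\ge0}}(-1)^a\sum_{\substack{r+s=a\\ r,s\ge0}}\binom{r+l+1}{r}\binom{s+m+1}{s}(-1)^{s+m+1}\Bigl\{\binom{a+b+3}{s+m+2}+(-1)^{s+m}\Bigr\}\\ &+2(-1)^a\sum_{\substack{r+s=a\\ r,s\ge0}}\binom{r+b+1}{r}(-1)^s\Bigl\{\binom{a+b+3}{s+1}+(-1)^{s+1}\Bigr\}\\ &+\sum_{\substack{m+n=a-1\\ m,n\ge0}}(-1)^n\sum_{\substack{r+s=n\\ r,s\ge0}}\binom{r+b+1}{r}\binom{s+m+1}{s}(-1)^{s+m+1}\Bigl\{\binom{a+b+3}{s+m+2}+(-1)^{s+m}\Bigr\}. \end{align*} Then $C=1+(-1)^a\binom{a+b+3}{b+2}$.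
   Context: Sums over empty ranges (e.g. $l+m=b-1$ when $b=0$, or $m+n=a-1$ when $a=0$) are zero. -}

module Defs where

open import Data.Nat using (ℕ; zero; suc; _+_; _∸_)
open import Data.Nat.Combinatorics using (_C_)
open import Data.Integer using (ℤ; +_; -_) renaming (_+_ to _+ℤ_; _*_ to _*ℤ_)

sgn : ℕ → ℤ
sgn zero = + 1
sgn (suc k) = - sgn k

bin : ℕ → ℕ → ℤ
bin n k = + (n C k)

sumTo : ℕ → (ℕ → ℤ) → ℤ
sumTo zero f = f 0
sumTo (suc n) f = sumTo n f +ℤ f (suc n)

sumPairs : ℕ → (ℕ → ℕ → ℤ) → ℤ
sumPairs n f = sumTo n (λ r → f r (n ∸ r))

-- Σ over pairs (r , s) with r + s = n - 1, r, s ≥ 0; empty (= 0) when n = 0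
sumPairsPred : ℕ → (ℕ → ℕ → ℤ) → ℤ
sumPairsPred zero f = + 0
sumPairsPred (suc n) f = sumPairs n f

termC1 : ℕ → ℕ → ℤ
termC1 a b = sumPairsPred b (λ l m →
  sgn a *ℤ sumPairs a (λ r s →
    bin (r + l + 1) r *ℤ bin (s + m + 1) s *ℤ sgn (s + m + 1)
      *ℤ (bin (a + b + 3) (s + m + 2) +ℤ sgn (s + m))))

termC2 : ℕ → ℕ → ℤ
termC2 a b = (+ 2) *ℤ sgn a *ℤ sumPairs a (λ r s →
  bin (r + b + 1) r *ℤ sgn s *ℤ (bin (a + b + 3) (s + 1) +ℤ sgn (s + 1)))

termC3 : ℕ → ℕ → ℤ
termC3 a b = sumPairsPred a (λ m n →
  sgn n *ℤ sumPairs n (λ r s →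
    bin (r + b + 1) r *ℤ bin (s + m + 1) s *ℤ sgn (s + m + 1)
      *ℤ (bin (a + b + 3) (s + m + 2) +ℤ sgn (s + m))))

C : ℕ → ℕ → ℤ
C a b = termC1 a b +ℤ termC2 a b +ℤ termC3 a b

-- Write g(k) = (-1)^(k+1) (C(N,k+2) + (-1)^k) with N = a+b+3; every summand of C carries a
-- factor g(s+m). By the alternating row sum Σ_{t≤p} (-1)^t C(p+1,t) = (-1)^p the third summand
-- collapses to -(-1)^a S with S = Σ_{r<a} C(r+b+1,r) g(a-1-r), and the second one equals
-- 2(-1)^a (S + C(a+b+1,a)(N-1)). For an arbitrary sequence g, the first summand divided by (-1)^a
-- and C(a+b+1,a) Σ_{k<a+b} g(k) - Σ_{k<a+b} g(k) C(k+1,b+1) - S satisfy the same Pascal-type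
-- recursion in (a,b) with the same boundary values, so they agree. What is left are the moments
-- Σ_{k<a+b} g(k) C(k+1,c), which for even a+b follow from the vanishing of Σ_j (-1)^j C(N,j) P(j)
-- for the polynomial P(j) = C(j-1,c) of degree c < N.

module Submission where

open import Defs
open import Data.Nat using (ℕ; zero; suc; _+_; _∸_; _*_; _≤_; _<_; z≤n; s≤s)
import Data.Nat.Properties as ℕ
open import Data.Nat.Divisibility using (_∣_; divides)
open import Data.Nat.Combinatorics
  using (nCk+nC[k+1]≡[n+1]C[k+1]; k>n⇒nCk≡0; nCk≡nC[n∸k]; nCn≡1; nC1≡n)
  renaming (_C_ to _Ch_)
open import Data.Integer using (ℤ; +_; -_) renaming (_+_ to _+ℤ_; _*_ to _*ℤ_; _-_ to _-ℤ_)
import Data.Integer.Properties as ℤ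
open import Data.Integer.Tactic.RingSolver using (solve-∀)
open import Relation.Binary.PropositionalEquality
  using (_≡_; refl; sym; trans; cong; cong₂; module ≡-Reasoning)

∑< : ℕ → (ℕ → ℤ) → ℤ
∑< zero    f = + 0
∑< (suc n) f = ∑< n f +ℤ f n

infix 5 ∑<
syntax ∑< n (λ i → e) = ∑[ i < n ] e

sumTo≡∑< : ∀ n f → sumTo n f ≡ ∑< (suc n) f
sumTo≡∑< zero    f = sym (ℤ.+-identityˡ (f 0))
sumTo≡∑< (suc n) f = cong (_+ℤ f (suc n)) (sumTo≡∑< n f)

∑<-cong-< : ∀ n {f g : ℕ → ℤ} → (∀ i → i < n → f i ≡ g i) → ∑< n f ≡ ∑< n g
∑<-cong-< zero    f≡g = refl
∑<-cong-< (suc n) f≡g = cong₂ _+ℤ_ (∑<-cong-< n (λ i i<n → f≡g i (ℕ.m<n⇒m<1+n i<n))) (f≡g n (ℕ.n<1+n n))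

∑<-cong : ∀ n {f g : ℕ → ℤ} → (∀ i → f i ≡ g i) → ∑< n f ≡ ∑< n g
∑<-cong n f≡g = ∑<-cong-< n (λ i _ → f≡g i)

∑<-zero : ∀ n (f : ℕ → ℤ) → (∀ i → i < n → f i ≡ + 0) → ∑< n f ≡ + 0
∑<-zero zero    f f≡0 = refl
∑<-zero (suc n) f f≡0 =
  cong₂ _+ℤ_ (∑<-zero n f (λ i i<n → f≡0 i (ℕ.m<n⇒m<1+n i<n))) (f≡0 n (ℕ.n<1+n n))

∑<-distrib-+ : ∀ n (f g : ℕ → ℤ) → ∑[ i < n ] f i +ℤ g i ≡ ∑< n f +ℤ ∑< n g
∑<-distrib-+ zero    f g = refl
∑<-distrib-+ (suc n) f g =
  trans (cong (_+ℤ (f n +ℤ g n)) (∑<-distrib-+ n f g)) (interchange (∑< n f) (∑< n g) (f n) (g n))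
  where
  interchange : ∀ w x y z → (w +ℤ x) +ℤ (y +ℤ z) ≡ (w +ℤ y) +ℤ (x +ℤ z)
  interchange = solve-∀

∑<-distribˡ-* : ∀ n c (f : ℕ → ℤ) → ∑[ i < n ] c *ℤ f i ≡ c *ℤ ∑< n f
∑<-distribˡ-* zero    c f = sym (ℤ.*-zeroʳ c)
∑<-distribˡ-* (suc n) c f =
  trans (cong (_+ℤ (c *ℤ f n)) (∑<-distribˡ-* n c f)) (sym (ℤ.*-distribˡ-+ c (∑< n f) (f n)))

∑<-distrib-neg : ∀ n (f : ℕ → ℤ) → ∑[ i < n ] - f i ≡ - ∑< n f
∑<-distrib-neg zero    f = refl
∑<-distrib-neg (suc n) f =
  trans (cong (_+ℤ (- f n)) (∑<-distrib-neg n f)) (sym (ℤ.neg-distrib-+ (∑< n f) (f n)))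

∑<-suc : ∀ n (f : ℕ → ℤ) → ∑< (suc n) f ≡ f 0 +ℤ (∑[ i < n ] f (suc i))
∑<-suc zero    f = trans (ℤ.+-identityˡ (f 0)) (sym (ℤ.+-identityʳ (f 0)))
∑<-suc (suc n) f = trans (cong (_+ℤ f (suc n)) (∑<-suc n f)) (ℤ.+-assoc (f 0) _ _)

∑<-+ : ∀ m n (f : ℕ → ℤ) → ∑< (m + n) f ≡ ∑< m f +ℤ (∑[ i < n ] f (m + i))
∑<-+ zero    n f = sym (ℤ.+-identityˡ _)
∑<-+ (suc m) n f = begin
  ∑< (suc (m + n)) f                                             ≡⟨ ∑<-suc (m + n) f ⟩
  f 0 +ℤ (∑[ i < m + n ] f (suc i))
    ≡⟨ cong (f 0 +ℤ_) (∑<-+ m n (λ i → f (suc i))) ⟩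
  f 0 +ℤ ((∑[ i < m ] f (suc i)) +ℤ (∑[ i < n ] f (suc (m + i))))
    ≡⟨ sym (ℤ.+-assoc (f 0) _ _) ⟩
  f 0 +ℤ (∑[ i < m ] f (suc i)) +ℤ (∑[ i < n ] f (suc (m + i)))
    ≡⟨ cong (_+ℤ (∑[ i < n ] f (suc (m + i)))) (sym (∑<-suc m f)) ⟩
  ∑< (suc m) f +ℤ (∑[ i < n ] f (suc m + i))
    ∎
  where open ≡-Reasoning

∑<-reverse : ∀ n (f : ℕ → ℤ) → ∑< n f ≡ ∑[ i < n ] f (n ∸ suc i)
∑<-reverse zero    f = refl
∑<-reverse (suc n) f = begin
  ∑< n f +ℤ f n                           ≡⟨ cong (_+ℤ f n) (∑<-reverse n f) ⟩
  (∑[ i < n ] f (n ∸ suc i)) +ℤ f n       ≡⟨ ℤ.+-comm _ (f n) ⟩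
  f n +ℤ (∑[ i < n ] f (n ∸ suc i))       ≡⟨ sym (∑<-suc n (λ i → f (n ∸ i))) ⟩
  ∑[ i < suc n ] f (n ∸ i)                ∎
  where open ≡-Reasoning

∑<-triangle : ∀ n (F : ℕ → ℕ → ℤ) →
  ∑[ i < n ] ∑[ j < suc i ] F i j ≡ ∑[ j < n ] ∑[ t < n ∸ j ] F (j + t) j
∑<-triangle zero    F = refl
∑<-triangle (suc n) F = begin
  (∑[ i < n ] ∑< (suc i) (F i)) +ℤ ∑< (suc n) (F n)
    ≡⟨ cong (_+ℤ ∑< (suc n) (F n)) (∑<-triangle n F) ⟩
  (∑[ j < n ] ∑[ t < n ∸ j ] F (j + t) j) +ℤ ∑< (suc n) (F n)
    ≡⟨ cong (_+ℤ ∑< (suc n) (F n)) (sym (ℤ.+-identityʳ (∑[ j < n ] ∑[ t < n ∸ j ] F (j + t) j))) ⟩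
  (∑[ j < n ] ∑[ t < n ∸ j ] F (j + t) j) +ℤ (∑[ t < 0 ] F (n + t) n) +ℤ ∑< (suc n) (F n)
    ≡⟨ cong (λ k → (∑[ j < n ] ∑[ t < n ∸ j ] F (j + t) j) +ℤ (∑[ t < k ] F (n + t) n) +ℤ ∑< (suc n) (F n))
            (sym (ℕ.n∸n≡0 n)) ⟩
  (∑[ j < suc n ] ∑[ t < n ∸ j ] F (j + t) j) +ℤ ∑< (suc n) (F n)
    ≡⟨ sym (∑<-distrib-+ (suc n) _ _) ⟩
  ∑[ j < suc n ] (∑[ t < n ∸ j ] F (j + t) j) +ℤ F n j
    ≡⟨ ∑<-cong-< (suc n) extend ⟩
  ∑[ j < suc n ] ∑[ t < suc n ∸ j ] F (j + t) j
    ∎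
  where
  open ≡-Reasoning
  extend : ∀ j → j < suc n → (∑[ t < n ∸ j ] F (j + t) j) +ℤ F n j ≡ ∑[ t < suc n ∸ j ] F (j + t) j
  extend j (s≤s j≤n) rewrite ℕ.+-∸-assoc 1 j≤n =
    cong (λ k → (∑[ t < n ∸ j ] F (j + t) j) +ℤ F k j) (sym (ℕ.m+[n∸m]≡n j≤n))

sgn-+ : ∀ m n → sgn (m + n) ≡ sgn m *ℤ sgn n
sgn-+ zero    n = sym (ℤ.*-identityˡ (sgn n))
sgn-+ (suc m) n = trans (cong -_ (sgn-+ m n)) (ℤ.neg-distribˡ-* (sgn m) (sgn n))

sgn*sgn≡1 : ∀ n → sgn n *ℤ sgn n ≡ + 1
sgn*sgn≡1 zero    = refl
sgn*sgn≡1 (suc n) = trans (negate-both (sgn n)) (sgn*sgn≡1 n)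
  where
  negate-both : ∀ x → (- x) *ℤ (- x) ≡ x *ℤ x
  negate-both = solve-∀

sgn-2+ : ∀ n → sgn (2 + n) ≡ sgn n
sgn-2+ n = ℤ.neg-involutive (sgn n)

sgn-even : ∀ q → sgn (q * 2) ≡ + 1
sgn-even zero    = refl
sgn-even (suc q) = trans (sgn-2+ (q * 2)) (sgn-even q)

sgn-parity : ∀ m n → sgn (m + n) ≡ + 1 → sgn n ≡ sgn m
sgn-parity m n even = begin
  sgn n                        ≡⟨ sym (ℤ.*-identityˡ (sgn n)) ⟩
  + 1 *ℤ sgn n                 ≡⟨ cong (_*ℤ sgn n) (sym (sgn*sgn≡1 m)) ⟩
  sgn m *ℤ sgn m *ℤ sgn n      ≡⟨ ℤ.*-assoc (sgn m) (sgn m) (sgn n) ⟩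
  sgn m *ℤ (sgn m *ℤ sgn n)    ≡⟨ cong (sgn m *ℤ_) (trans (sym (sgn-+ m n)) even) ⟩
  sgn m *ℤ + 1                 ≡⟨ ℤ.*-identityʳ (sgn m) ⟩
  sgn m                        ∎
  where open ≡-Reasoning

[1+n]Cn≡1+n : ∀ n → suc n Ch n ≡ suc n
[1+n]Cn≡1+n zero    = refl
[1+n]Cn≡1+n (suc n) = begin
  suc (suc n) Ch suc n          ≡⟨ sym (nCk+nC[k+1]≡[n+1]C[k+1] (suc n) n) ⟩
  suc n Ch n + suc n Ch suc n   ≡⟨ cong₂ _+_ ([1+n]Cn≡1+n n) (nCn≡1 (suc n)) ⟩
  suc n + 1                     ≡⟨ ℕ.+-comm (suc n) 1 ⟩
  suc (suc n)                   ∎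
  where open ≡-Reasoning

[m+n]Cm≡[m+n]Cn : ∀ m n → (m + n) Ch m ≡ (m + n) Ch n
[m+n]Cm≡[m+n]Cn m n = trans (nCk≡nC[n∸k] (ℕ.m≤m+n m n)) (cong ((m + n) Ch_) (ℕ.m+n∸m≡n m n))

bin-pascal : ∀ n k → bin (suc n) (suc k) ≡ bin n k +ℤ bin n (suc k)
bin-pascal n k = trans (cong +_ (sym (nCk+nC[k+1]≡[n+1]C[k+1] n k))) (ℤ.pos-+ (n Ch k) (n Ch suc k))

bin-sym : ∀ {n} m k → m + k ≡ n → bin n m ≡ bin n k
bin-sym m k refl = cong +_ ([m+n]Cm≡[m+n]Cn m k)

n<k⇒bin≡0 : ∀ {n k} → n < k → bin n k ≡ + 0
n<k⇒bin≡0 n<k = cong +_ (k>n⇒nCk≡0 n<k)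

∑<-bin-hockey : ∀ n c → ∑[ k < n ] bin k c ≡ bin n (suc c)
∑<-bin-hockey zero    c = refl
∑<-bin-hockey (suc n) c = begin
  (∑[ k < n ] bin k c) +ℤ bin n c ≡⟨ cong (_+ℤ bin n c) (∑<-bin-hockey n c) ⟩
  bin n (suc c) +ℤ bin n c        ≡⟨ ℤ.+-comm (bin n (suc c)) (bin n c) ⟩
  bin n c +ℤ bin n (suc c)        ≡⟨ sym (bin-pascal n c) ⟩
  bin (suc n) (suc c)             ∎
  where open ≡-Reasoning

∑<-alternating-bin : ∀ p n → ∑[ j < suc p ] sgn j *ℤ bin (suc n) j ≡ sgn p *ℤ bin n p
∑<-alternating-bin zero    n = refl
∑<-alternating-bin (suc p) n = begin
  (∑[ j < suc p ] sgn j *ℤ bin (suc n) j) +ℤ sgn (suc p) *ℤ bin (suc n) (suc p)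
    ≡⟨ cong₂ (λ u v → u +ℤ (- sgn p) *ℤ v) (∑<-alternating-bin p n) (bin-pascal n p) ⟩
  sgn p *ℤ bin n p +ℤ (- sgn p) *ℤ (bin n p +ℤ bin n (suc p))
    ≡⟨ telescope (sgn p) (bin n p) (bin n (suc p)) ⟩
  (- sgn p) *ℤ bin n (suc p)
    ∎
  where
  open ≡-Reasoning
  telescope : ∀ s x y → s *ℤ x +ℤ (- s) *ℤ (x +ℤ y) ≡ (- s) *ℤ y
  telescope = solve-∀

∑<-alternating-shift : ∀ n (f : ℕ → ℤ) →
  ∑[ j < suc n ] sgn j *ℤ (bin n j *ℤ f j) ≡ f 0 -ℤ (∑[ j < n ] sgn j *ℤ (bin n (suc j) *ℤ f (suc j)))
∑<-alternating-shift n f = begin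
  ∑[ j < suc n ] sgn j *ℤ (bin n j *ℤ f j)
    ≡⟨ ∑<-suc n _ ⟩
  + 1 *ℤ (+ 1 *ℤ f 0) +ℤ (∑[ j < n ] (- sgn j) *ℤ (bin n (suc j) *ℤ f (suc j)))
    ≡⟨ cong₂ _+ℤ_ (trans (ℤ.*-identityˡ _) (ℤ.*-identityˡ (f 0)))
                  (trans (∑<-cong n (λ j → sym (ℤ.neg-distribˡ-* (sgn j) _))) (∑<-distrib-neg n _)) ⟩
  f 0 -ℤ (∑[ j < n ] sgn j *ℤ (bin n (suc j) *ℤ f (suc j)))
    ∎
  where open ≡-Reasoning

∑<-alternating-difference : ∀ n (f : ℕ → ℤ) →
  ∑[ j < suc (suc n) ] sgn j *ℤ (bin (suc n) j *ℤ f j)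
    ≡ ∑[ j < suc n ] sgn j *ℤ (bin n j *ℤ (f j -ℤ f (suc j)))
∑<-alternating-difference n f = begin
  ∑[ j < suc (suc n) ] sgn j *ℤ (bin (suc n) j *ℤ f j)
    ≡⟨ ∑<-alternating-shift (suc n) f ⟩
  f 0 -ℤ (∑[ j < suc n ] sgn j *ℤ (bin (suc n) (suc j) *ℤ f (suc j)))
    ≡⟨ cong (f 0 -ℤ_) (trans (∑<-cong (suc n) (λ j → cong (λ x → sgn j *ℤ (x *ℤ f (suc j))) (bin-pascal n j)))
                              (trans (∑<-cong (suc n) (λ j → split (sgn j) (bin n j) (bin n (suc j)) (f (suc j))))
                                     (∑<-distrib-+ (suc n) _ _))) ⟩
  f 0 -ℤ (low +ℤ (shifted +ℤ top))
    ≡⟨ cong (λ t → f 0 -ℤ (low +ℤ (shifted +ℤ t))) top≡0 ⟩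
  f 0 -ℤ (low +ℤ (shifted +ℤ + 0))
    ≡⟨ regroup (f 0) low _ ⟩
  (f 0 -ℤ shifted) -ℤ low
    ≡⟨ cong (_-ℤ low) (sym (∑<-alternating-shift n f)) ⟩
  whole -ℤ low
    ≡⟨ cong (whole +ℤ_) (sym (∑<-distrib-neg (suc n) (λ j → sgn j *ℤ (bin n j *ℤ f (suc j))))) ⟩
  whole +ℤ (∑[ j < suc n ] - (sgn j *ℤ (bin n j *ℤ f (suc j))))
    ≡⟨ sym (∑<-distrib-+ (suc n) _ _) ⟩
  ∑[ j < suc n ] sgn j *ℤ (bin n j *ℤ f j) +ℤ - (sgn j *ℤ (bin n j *ℤ f (suc j)))
    ≡⟨ ∑<-cong (suc n) (λ j → factor (sgn j) (bin n j) (f j) (f (suc j))) ⟩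
  ∑[ j < suc n ] sgn j *ℤ (bin n j *ℤ (f j -ℤ f (suc j)))
    ∎
  where
  open ≡-Reasoning
  whole low shifted top : ℤ
  whole = ∑[ j < suc n ] sgn j *ℤ (bin n j *ℤ f j)
  low = ∑[ j < suc n ] sgn j *ℤ (bin n j *ℤ f (suc j))
  shifted = ∑[ j < n ] sgn j *ℤ (bin n (suc j) *ℤ f (suc j))
  top = sgn n *ℤ (bin n (suc n) *ℤ f (suc n))
  top≡0 : top ≡ + 0
  top≡0 = trans (cong (λ x → sgn n *ℤ (x *ℤ f (suc n))) (n<k⇒bin≡0 (ℕ.n<1+n n)))
                (trans (cong (sgn n *ℤ_) (ℤ.*-zeroˡ (f (suc n)))) (ℤ.*-zeroʳ (sgn n)))
  split : ∀ s x y z → s *ℤ ((x +ℤ y) *ℤ z) ≡ s *ℤ (x *ℤ z) +ℤ s *ℤ (y *ℤ z)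
  split = solve-∀
  regroup : ∀ x l h → x -ℤ (l +ℤ (h +ℤ + 0)) ≡ (x -ℤ h) -ℤ l
  regroup = solve-∀
  factor : ∀ s c x y → s *ℤ (c *ℤ x) +ℤ - (s *ℤ (c *ℤ y)) ≡ s *ℤ (c *ℤ (x -ℤ y))
  factor = solve-∀

-- C(j - 1, c) as a polynomial in j of degree c, whose value at j = 0 is (-1)^c.
predBin : ℕ → ℕ → ℤ
predBin c zero    = sgn c
predBin c (suc j) = bin j c

predBin-difference : ∀ c j → predBin (suc c) j -ℤ predBin (suc c) (suc j) ≡ - predBin c j
predBin-difference c zero    = ℤ.+-identityʳ (- sgn c)
predBin-difference c (suc j) =
  trans (cong (bin j (suc c) -ℤ_) (bin-pascal j c)) (cancel (bin j c) (bin j (suc c)))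
  where
  cancel : ∀ x y → y -ℤ (x +ℤ y) ≡ - x
  cancel = solve-∀

∑<-alternating-predBin : ∀ n c → c ≤ n →
  ∑[ j < suc (suc n) ] sgn j *ℤ (bin (suc n) j *ℤ predBin c j) ≡ + 0
∑<-alternating-predBin n zero _ =
  trans (∑<-alternating-difference n (predBin 0)) (∑<-zero (suc n) _ (λ j _ → vanish j))
  where
  vanish : ∀ j → sgn j *ℤ (bin n j *ℤ (predBin 0 j -ℤ predBin 0 (suc j))) ≡ + 0
  vanish zero    = ℤ.*-zeroʳ (bin n 0)
  vanish (suc j) = trans (cong (sgn (suc j) *ℤ_) (ℤ.*-zeroʳ (bin n (suc j)))) (ℤ.*-zeroʳ (sgn (suc j)))
∑<-alternating-predBin (suc n) (suc c) (s≤s c≤n) = begin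
  ∑[ j < suc (suc (suc n)) ] sgn j *ℤ (bin (suc (suc n)) j *ℤ predBin (suc c) j)
    ≡⟨ ∑<-alternating-difference (suc n) (predBin (suc c)) ⟩
  ∑[ j < suc (suc n) ] sgn j *ℤ (bin (suc n) j *ℤ (predBin (suc c) j -ℤ predBin (suc c) (suc j)))
    ≡⟨ ∑<-cong (suc (suc n)) (λ j → trans (cong (λ x → sgn j *ℤ (bin (suc n) j *ℤ x)) (predBin-difference c j))
                                        (pull-neg (sgn j) (bin (suc n) j) (predBin c j))) ⟩
  ∑[ j < suc (suc n) ] - (sgn j *ℤ (bin (suc n) j *ℤ predBin c j))
    ≡⟨ ∑<-distrib-neg (suc (suc n)) _ ⟩
  - (∑[ j < suc (suc n) ] sgn j *ℤ (bin (suc n) j *ℤ predBin c j))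
    ≡⟨ cong -_ (∑<-alternating-predBin n c c≤n) ⟩
  + 0
    ∎
  where
  open ≡-Reasoning
  pull-neg : ∀ s x y → s *ℤ (x *ℤ (- y)) ≡ - (s *ℤ (x *ℤ y))
  pull-neg = solve-∀

r+l+1≡1+r+l : ∀ r l → r + l + 1 ≡ suc r + l
r+l+1≡1+r+l r l = ℕ.+-comm (r + l) 1

∑<-pascal : ∀ n k (x : ℕ → ℤ) →
  ∑[ r < suc n ] bin (suc r + k) r *ℤ x r
    ≡ (∑[ r < suc n ] bin (r + k) r *ℤ x r) +ℤ (∑[ r < n ] bin (suc r + k) r *ℤ x (suc r))
∑<-pascal n k x = begin
  ∑[ r < suc n ] bin (suc r + k) r *ℤ x r
    ≡⟨ ∑<-suc n _ ⟩
  x₀ +ℤ (∑[ r < n ] bin (suc (suc r + k)) (suc r) *ℤ x (suc r))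
    ≡⟨ cong (x₀ +ℤ_) (trans (∑<-cong n (λ r → cong (_*ℤ x (suc r)) (bin-pascal (suc r + k) r)))
                            (trans (∑<-cong n (λ r → ℤ.*-distribʳ-+ (x (suc r)) (bin (suc r + k) r)
                                                                      (bin (suc r + k) (suc r))))
                                   (∑<-distrib-+ n _ _))) ⟩
  x₀ +ℤ (same +ℤ shiftedUp)
    ≡⟨ reorder x₀ same shiftedUp ⟩
  (x₀ +ℤ shiftedUp) +ℤ same
    ≡⟨ cong (_+ℤ same) (sym (∑<-suc n (λ r → bin (r + k) r *ℤ x r))) ⟩
  (∑[ r < suc n ] bin (r + k) r *ℤ x r) +ℤ same
    ∎
  where
  open ≡-Reasoning
  x₀ same shiftedUp : ℤ
  x₀ = bin (1 + k) 0 *ℤ x 0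
  same = ∑[ r < n ] bin (suc r + k) r *ℤ x (suc r)
  shiftedUp = ∑[ r < n ] bin (suc r + k) (suc r) *ℤ x (suc r)
  reorder : ∀ u v w → u +ℤ (v +ℤ w) ≡ (u +ℤ w) +ℤ v
  reorder = solve-∀

∑<-pascal′ : ∀ n l (x : ℕ → ℤ) →
  ∑[ r < suc n ] bin (r + suc l + 1) r *ℤ x r
    ≡ (∑[ r < suc n ] bin (r + l + 1) r *ℤ x r) +ℤ (∑[ r < n ] bin (r + suc l + 1) r *ℤ x (suc r))
∑<-pascal′ n l x = begin
  ∑[ r < suc n ] bin (r + suc l + 1) r *ℤ x r
    ≡⟨ ∑<-cong (suc n) (λ r → cong (λ k → bin k r *ℤ x r) (r+l+1≡1+r+l r (suc l))) ⟩
  ∑[ r < suc n ] bin (suc r + suc l) r *ℤ x r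
    ≡⟨ ∑<-pascal n (suc l) x ⟩
  (∑[ r < suc n ] bin (r + suc l) r *ℤ x r) +ℤ (∑[ r < n ] bin (suc r + suc l) r *ℤ x (suc r))
    ≡⟨ cong₂ _+ℤ_
         (∑<-cong (suc n) (λ r → cong (λ k → bin k r *ℤ x r) (trans (ℕ.+-suc r l) (sym (r+l+1≡1+r+l r l)))))
         (∑<-cong n (λ r → cong (λ k → bin k r *ℤ x (suc r)) (sym (r+l+1≡1+r+l r (suc l))))) ⟩
  (∑[ r < suc n ] bin (r + l + 1) r *ℤ x r) +ℤ (∑[ r < n ] bin (r + suc l + 1) r *ℤ x (suc r))
    ∎
  where open ≡-Reasoning

pascal-recursion-unique : ∀ {f g : ℕ → ℕ → ℤ} (e : ℕ → ℕ → ℤ) →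
  (∀ a b → f (suc a) (suc b) ≡ f (suc a) b +ℤ f a (suc b) +ℤ e a b) →
  (∀ a b → g (suc a) (suc b) ≡ g (suc a) b +ℤ g a (suc b) +ℤ e a b) →
  (∀ b → f 0 b ≡ g 0 b) → (∀ a → f a 0 ≡ g a 0) → ∀ a b → f a b ≡ g a b
pascal-recursion-unique {f} {g} e rec-f rec-g edgeˡ edgeʳ = go
  where
  go : ∀ a b → f a b ≡ g a b
  go zero    b       = edgeˡ b
  go (suc a) zero    = edgeʳ (suc a)
  go (suc a) (suc b) =
    trans (rec-f a b) (trans (cong (_+ℤ e a b) (cong₂ _+ℤ_ (go (suc a) b) (go a (suc b)))) (sym (rec-g a b)))

module DoubleSum (G : ℕ → ℤ) where

  φ : ℕ → ℕ → ℤ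
  φ s m = bin (s + m + 1) s *ℤ G (s + m)

  innerSum : ℕ → ℕ → ℕ → ℤ
  innerSum a l m = ∑[ r < suc a ] bin (r + l + 1) r *ℤ φ (a ∸ r) m

  doubleSum : ℕ → ℕ → ℤ
  doubleSum a b = ∑[ l < b ] innerSum a l (b ∸ suc l)

  rowSum : ℕ → ℕ → ℤ
  rowSum a m = ∑[ s < suc a ] φ s m

  convolution : ℕ → ℕ → ℤ
  convolution a b = ∑[ r < a ] bin (r + b + 1) r *ℤ G (a ∸ suc r)

  moment : ℕ → ℕ → ℤ
  moment n c = ∑[ k < n ] G k *ℤ bin (suc k) c

  closedForm : ℕ → ℕ → ℤ
  closedForm a b = bin (suc (a + b)) a *ℤ ∑< (a + b) G -ℤ moment (a + b) (suc b) -ℤ convolution a b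

  innerSum-suc : ∀ a l m → innerSum (suc a) (suc l) m ≡ innerSum (suc a) l m +ℤ innerSum a (suc l) m
  innerSum-suc a l m = ∑<-pascal′ (suc a) l (λ r → φ (suc a ∸ r) m)

  convolution-suc : ∀ a b → convolution (suc a) (suc b) ≡ convolution (suc a) b +ℤ convolution a (suc b)
  convolution-suc a b = ∑<-pascal′ a b (λ r → G (a ∸ r))

  innerSum-zero : ∀ a m → innerSum (suc a) 0 m ≡ innerSum a 0 m +ℤ rowSum (suc a) m
  innerSum-zero a m = begin
    innerSum (suc a) 0 m
      ≡⟨ ∑<-cong (suc (suc a)) (λ r → cong (λ k → bin k r *ℤ x r) (r+l+1≡1+r+l r 0)) ⟩
    ∑[ r < suc (suc a) ] bin (suc r + 0) r *ℤ x r
      ≡⟨ ∑<-pascal (suc a) 0 x ⟩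
    (∑[ r < suc (suc a) ] bin (r + 0) r *ℤ x r) +ℤ (∑[ r < suc a ] bin (suc r + 0) r *ℤ x (suc r))
      ≡⟨ cong₂ _+ℤ_ (trans (∑<-cong (suc (suc a)) diagonal) (sym (∑<-reverse (suc (suc a)) (λ s → φ s m))))
                    (∑<-cong (suc a) (λ r → cong (λ k → bin k r *ℤ x (suc r)) (sym (r+l+1≡1+r+l r 0)))) ⟩
    rowSum (suc a) m +ℤ innerSum a 0 m
      ≡⟨ ℤ.+-comm (rowSum (suc a) m) (innerSum a 0 m) ⟩
    innerSum a 0 m +ℤ rowSum (suc a) m
      ∎
    where
    open ≡-Reasoning
    x : ℕ → ℤ
    x r = φ (suc a ∸ r) m
    diagonal : ∀ r → bin (r + 0) r *ℤ x r ≡ x r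
    diagonal r = trans (cong (λ k → bin k r *ℤ x r) (ℕ.+-identityʳ r))
                       (trans (cong (λ c → + c *ℤ x r) (nCn≡1 r)) (ℤ.*-identityˡ (x r)))

  doubleSum-suc : ∀ a b →
    doubleSum (suc a) (suc b) ≡ doubleSum (suc a) b +ℤ doubleSum a (suc b) +ℤ rowSum (suc a) b
  doubleSum-suc a b = begin
    doubleSum (suc a) (suc b)
      ≡⟨ ∑<-suc b _ ⟩
    innerSum (suc a) 0 b +ℤ (∑[ l < b ] innerSum (suc a) (suc l) (b ∸ suc l))
      ≡⟨ cong₂ _+ℤ_ (innerSum-zero a b)
                    (trans (∑<-cong b (λ l → innerSum-suc a l (b ∸ suc l))) (∑<-distrib-+ b _ _)) ⟩
    (innerSum a 0 b +ℤ rowSum (suc a) b) +ℤ (doubleSum (suc a) b +ℤ tail)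
      ≡⟨ reorder (innerSum a 0 b) (rowSum (suc a) b) (doubleSum (suc a) b) tail ⟩
    doubleSum (suc a) b +ℤ (innerSum a 0 b +ℤ tail) +ℤ rowSum (suc a) b
      ≡⟨ cong (λ t → doubleSum (suc a) b +ℤ t +ℤ rowSum (suc a) b) (sym (∑<-suc b _)) ⟩
    doubleSum (suc a) b +ℤ doubleSum a (suc b) +ℤ rowSum (suc a) b
      ∎
    where
    open ≡-Reasoning
    tail : ℤ
    tail = ∑[ l < b ] innerSum a (suc l) (b ∸ suc l)
    reorder : ∀ i e q t → (i +ℤ e) +ℤ (q +ℤ t) ≡ q +ℤ (i +ℤ t) +ℤ e
    reorder = solve-∀

  moment≡rowSum : ∀ a b → moment (suc (a + b)) (suc b) ≡ rowSum a b
  moment≡rowSum a b = begin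
    moment (suc (a + b)) (suc b)
      ≡⟨ cong (λ n → moment n (suc b)) (trans (cong suc (ℕ.+-comm a b)) (sym (ℕ.+-suc b a))) ⟩
    moment (b + suc a) (suc b)
      ≡⟨ ∑<-+ b (suc a) _ ⟩
    moment b (suc b) +ℤ (∑[ i < suc a ] G (b + i) *ℤ bin (suc (b + i)) (suc b))
      ≡⟨ cong₂ _+ℤ_ (∑<-zero b _ below-diagonal) (∑<-cong (suc a) term) ⟩
    + 0 +ℤ rowSum a b
      ≡⟨ ℤ.+-identityˡ (rowSum a b) ⟩
    rowSum a b
      ∎
    where
    open ≡-Reasoning
    below-diagonal : ∀ k → k < b → G k *ℤ bin (suc k) (suc b) ≡ + 0
    below-diagonal k k<b = trans (cong (G k *ℤ_) (n<k⇒bin≡0 (s≤s k<b))) (ℤ.*-zeroʳ (G k))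
    term : ∀ i → G (b + i) *ℤ bin (suc (b + i)) (suc b) ≡ φ i b
    term i = begin
      G (b + i) *ℤ bin (suc (b + i)) (suc b)
        ≡⟨ cong (λ n → G n *ℤ bin (suc n) (suc b)) (ℕ.+-comm b i) ⟩
      G (i + b) *ℤ bin (suc (i + b)) (suc b)
        ≡⟨ cong (G (i + b) *ℤ_) (sym (bin-sym i (suc b) (ℕ.+-suc i b))) ⟩
      G (i + b) *ℤ bin (suc (i + b)) i
        ≡⟨ cong (λ n → G (i + b) *ℤ bin n i) (sym (r+l+1≡1+r+l i b)) ⟩
      G (i + b) *ℤ bin (i + b + 1) i
        ≡⟨ ℤ.*-comm (G (i + b)) (bin (i + b + 1) i) ⟩
      φ i b
        ∎

  closedForm-suc : ∀ a b →
    closedForm (suc a) (suc b) ≡ closedForm (suc a) b +ℤ closedForm a (suc b) +ℤ rowSum (suc a) b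
  closedForm-suc a b = begin
    closedForm (suc a) (suc b)
      ≡⟨ cong (λ k → bin (suc k) (suc a) *ℤ ∑< k G -ℤ moment k (2 + b) -ℤ convolution (suc a) (suc b))
              (cong suc (ℕ.+-suc a b)) ⟩
    bin (3 + n) (suc a) *ℤ ∑< (2 + n) G -ℤ moment (2 + n) (2 + b) -ℤ convolution (suc a) (suc b)
      -- Pascal on C(n+3,a+1); by symmetry C(n+2,a) = C(n+2,b+2), so the G(n+1)-terms will cancel.
      ≡⟨ cong₃ (bin-pascal (2 + n) a) (cong (λ c → M₂ +ℤ G n *ℤ c₂ +ℤ G (suc n) *ℤ c) (sym X≡))
               (convolution-suc a b) ⟩
    (X +ℤ Y) *ℤ (Σ +ℤ G n +ℤ G (suc n)) -ℤ (M₂ +ℤ G n *ℤ c₂ +ℤ G (suc n) *ℤ X)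
      -ℤ (S₁ +ℤ S₂)
      ≡⟨ pascal-step X Y Σ (G n) (G (suc n)) M₁ M₂ c₁ c₂ S₁ S₂ ⟩
    closedForm (suc a) b
      +ℤ (X *ℤ (Σ +ℤ G n) -ℤ (M₂ +ℤ G n *ℤ c₂) -ℤ S₂)
      +ℤ (M₁ +ℤ G n *ℤ c₁ +ℤ G (suc n) *ℤ Y)
      ≡⟨ cong₂ (λ u v → closedForm (suc a) b +ℤ u +ℤ v)
               (cong (λ k → bin (suc k) a *ℤ ∑< k G -ℤ moment k (2 + b) -ℤ convolution a (suc b))
                     (sym (ℕ.+-suc a b)))
               (trans (cong (λ c → M₁ +ℤ G n *ℤ c₁ +ℤ G (suc n) *ℤ c) Y≡) (moment≡rowSum (suc a) b)) ⟩
    closedForm (suc a) b +ℤ closedForm a (suc b) +ℤ rowSum (suc a) b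
      ∎
    where
    open ≡-Reasoning
    n = a + b
    X Y Σ M₁ M₂ c₁ c₂ S₁ S₂ : ℤ
    X = bin (2 + n) a
    Y = bin (2 + n) (suc a)
    Σ = ∑< n G
    M₁ = moment n (suc b)
    M₂ = moment n (2 + b)
    c₁ = bin (suc n) (suc b)
    c₂ = bin (suc n) (2 + b)
    S₁ = convolution (suc a) b
    S₂ = convolution a (suc b)
    X≡ : X ≡ bin (2 + n) (2 + b)
    X≡ = bin-sym a (2 + b) (trans (ℕ.+-suc a (suc b)) (cong suc (ℕ.+-suc a b)))
    Y≡ : Y ≡ bin (2 + n) (suc b)
    Y≡ = bin-sym (suc a) (suc b) (cong suc (ℕ.+-suc a b))
    cong₃ : ∀ {x x′ m m′ s s′} → x ≡ x′ → m ≡ m′ → s ≡ s′ →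
      x *ℤ ∑< (2 + n) G -ℤ m -ℤ s ≡ x′ *ℤ ∑< (2 + n) G -ℤ m′ -ℤ s′
    cong₃ refl refl refl = refl
    pascal-step : ∀ x y σ g g′ m₁ m₂ d₁ d₂ s₁ s₂ →
      (x +ℤ y) *ℤ (σ +ℤ g +ℤ g′) -ℤ (m₂ +ℤ g *ℤ d₂ +ℤ g′ *ℤ x) -ℤ (s₁ +ℤ s₂)
        ≡ (y *ℤ (σ +ℤ g) -ℤ (m₁ +ℤ g *ℤ d₁) -ℤ s₁) +ℤ (x *ℤ (σ +ℤ g) -ℤ (m₂ +ℤ g *ℤ d₂) -ℤ s₂)
          +ℤ (m₁ +ℤ g *ℤ d₁ +ℤ g′ *ℤ y)
    pascal-step = solve-∀

  scaledSum-moment : ∀ n x c → x *ℤ ∑< n G -ℤ moment n c ≡ ∑[ k < n ] G k *ℤ (x -ℤ bin (suc k) c)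
  scaledSum-moment zero    x c = trans (ℤ.+-identityʳ (x *ℤ + 0)) (ℤ.*-zeroʳ x)
  scaledSum-moment (suc n) x c =
    trans (step x (∑< n G) (moment n c) (G n) (bin (suc n) c))
          (cong (_+ℤ G n *ℤ (x -ℤ bin (suc n) c)) (scaledSum-moment n x c))
    where
    step : ∀ x σ m g d → x *ℤ (σ +ℤ g) -ℤ (m +ℤ g *ℤ d) ≡ (x *ℤ σ -ℤ m) +ℤ g *ℤ (x -ℤ d)
    step = solve-∀

  doubleSum-zeroˡ : ∀ b → doubleSum 0 b ≡ closedForm 0 b
  doubleSum-zeroˡ b = begin
    doubleSum 0 b                                ≡⟨ ∑<-cong b (λ l → one-term (G (b ∸ suc l))) ⟩
    ∑[ l < b ] G (b ∸ suc l)                     ≡⟨ sym (∑<-reverse b G) ⟩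
    ∑< b G                                       ≡⟨ sym (drop-zeros (∑< b G)) ⟩
    + 1 *ℤ ∑< b G -ℤ + 0 -ℤ + 0                  ≡⟨ cong (λ m → + 1 *ℤ ∑< b G -ℤ m -ℤ + 0) (sym moment-vanishes) ⟩
    closedForm 0 b                               ∎
    where
    open ≡-Reasoning
    one-term : ∀ x → + 0 +ℤ + 1 *ℤ (+ 1 *ℤ x) ≡ x
    one-term = solve-∀
    drop-zeros : ∀ x → + 1 *ℤ x -ℤ + 0 -ℤ + 0 ≡ x
    drop-zeros = solve-∀
    moment-vanishes : moment b (suc b) ≡ + 0
    moment-vanishes =
      ∑<-zero b _ (λ k k<b → trans (cong (G k *ℤ_) (n<k⇒bin≡0 (s≤s k<b))) (ℤ.*-zeroʳ (G k)))

  closedForm-zeroʳ : ∀ a → closedForm a 0 ≡ + 0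
  closedForm-zeroʳ a = begin
    closedForm a 0
      ≡⟨ cong (λ k → bin (suc k) a *ℤ ∑< k G -ℤ moment k 1 -ℤ convolution a 0) (ℕ.+-identityʳ a) ⟩
    bin (suc a) a *ℤ ∑< a G -ℤ moment a 1 -ℤ convolution a 0
      ≡⟨ cong (_-ℤ convolution a 0) (trans (scaledSum-moment a (bin (suc a) a) 1) (∑<-reverse a _)) ⟩
    (∑[ r < a ] G (a ∸ suc r) *ℤ (bin (suc a) a -ℤ bin (suc (a ∸ suc r)) 1)) -ℤ convolution a 0
      ≡⟨ cong (_-ℤ convolution a 0) (∑<-cong-< a term) ⟩
    convolution a 0 -ℤ convolution a 0
      ≡⟨ ℤ.+-inverseʳ (convolution a 0) ⟩
    + 0
      ∎
    where
    open ≡-Reasoning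
    term : ∀ r → r < a →
      G (a ∸ suc r) *ℤ (bin (suc a) a -ℤ bin (suc (a ∸ suc r)) 1) ≡ bin (r + 0 + 1) r *ℤ G (a ∸ suc r)
    term r r<a = begin
      G p *ℤ (bin (suc a) a -ℤ bin (suc p) 1)
        ≡⟨ cong₂ (λ u v → G p *ℤ (+ u -ℤ + v)) ([1+n]Cn≡1+n a) (nC1≡n (suc p)) ⟩
      G p *ℤ (+ suc a -ℤ + suc p)
        ≡⟨ cong (λ u → G p *ℤ (+ suc u -ℤ + suc p)) (sym (ℕ.m∸n+n≡m r<a)) ⟩
      G p *ℤ (+ (suc p + suc r) -ℤ + suc p)
        ≡⟨ cong (λ u → G p *ℤ (u -ℤ + suc p)) (ℤ.pos-+ (suc p) (suc r)) ⟩
      G p *ℤ (+ suc p +ℤ + suc r -ℤ + suc p)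
        ≡⟨ cancel (G p) (+ suc p) (+ suc r) ⟩
      + suc r *ℤ G p
        ≡⟨ cong (λ u → + u *ℤ G p) (sym ([1+n]Cn≡1+n r)) ⟩
      bin (suc r) r *ℤ G p
        ≡⟨ cong (λ k → bin k r *ℤ G p) (sym (trans (r+l+1≡1+r+l r 0) (ℕ.+-identityʳ (suc r)))) ⟩
      bin (r + 0 + 1) r *ℤ G p
        ∎
      where
      p = a ∸ suc r
      cancel : ∀ g x y → g *ℤ (x +ℤ y -ℤ x) ≡ y *ℤ g
      cancel = solve-∀

  doubleSum≡closedForm : ∀ a b → doubleSum a b ≡ closedForm a b
  doubleSum≡closedForm = pascal-recursion-unique (λ a b → rowSum (suc a) b)
    doubleSum-suc closedForm-suc doubleSum-zeroˡ (λ a → sym (closedForm-zeroʳ a))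

  ∑<-alternating-φ : ∀ p → ∑[ t < suc p ] sgn t *ℤ φ t (p ∸ t) ≡ sgn p *ℤ G p
  ∑<-alternating-φ p = begin
    ∑[ t < suc p ] sgn t *ℤ φ t (p ∸ t)
      ≡⟨ ∑<-cong-< (suc p) (λ t t≤p → diagonal t (ℕ.≤-pred t≤p)) ⟩
    ∑[ t < suc p ] G p *ℤ (sgn t *ℤ bin (suc p) t)
      ≡⟨ ∑<-distribˡ-* (suc p) (G p) _ ⟩
    G p *ℤ (∑[ t < suc p ] sgn t *ℤ bin (suc p) t)
      ≡⟨ cong (G p *ℤ_) (trans (∑<-alternating-bin p p) (cong (λ c → sgn p *ℤ + c) (nCn≡1 p))) ⟩
    G p *ℤ (sgn p *ℤ + 1)
      ≡⟨ swap (G p) (sgn p) ⟩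
    sgn p *ℤ G p
      ∎
    where
    open ≡-Reasoning
    swap : ∀ x s → x *ℤ (s *ℤ + 1) ≡ s *ℤ x
    swap = solve-∀
    rearrange : ∀ s c x → s *ℤ (c *ℤ x) ≡ x *ℤ (s *ℤ c)
    rearrange = solve-∀
    diagonal : ∀ t → t ≤ p → sgn t *ℤ φ t (p ∸ t) ≡ G p *ℤ (sgn t *ℤ bin (suc p) t)
    diagonal t t≤p = begin
      sgn t *ℤ (bin (t + (p ∸ t) + 1) t *ℤ G (t + (p ∸ t)))
        ≡⟨ cong (λ k → sgn t *ℤ (bin (k + 1) t *ℤ G k)) (ℕ.m+[n∸m]≡n t≤p) ⟩
      sgn t *ℤ (bin (p + 1) t *ℤ G p)
        ≡⟨ cong (λ k → sgn t *ℤ (bin k t *ℤ G p)) (ℕ.+-comm p 1) ⟩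
      sgn t *ℤ (bin (suc p) t *ℤ G p)
        ≡⟨ rearrange (sgn t) (bin (suc p) t) (G p) ⟩
      G p *ℤ (sgn t *ℤ bin (suc p) t)
        ∎

g : ℕ → ℕ → ℤ
g N k = sgn (k + 1) *ℤ (bin N (k + 2) +ℤ sgn k)

g-expand : ∀ N k → g N k ≡ - (sgn k *ℤ bin N (2 + k)) -ℤ + 1
g-expand N k = begin
  sgn (k + 1) *ℤ (bin N (k + 2) +ℤ sgn k)
    ≡⟨ cong₂ (λ i j → sgn i *ℤ (bin N j +ℤ sgn k)) (ℕ.+-comm k 1) (ℕ.+-comm k 2) ⟩
  (- sgn k) *ℤ (bin N (2 + k) +ℤ sgn k)
    ≡⟨ expand (sgn k) (bin N (2 + k)) ⟩
  - (sgn k *ℤ bin N (2 + k)) -ℤ sgn k *ℤ sgn k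
    ≡⟨ cong (λ x → - (sgn k *ℤ bin N (2 + k)) -ℤ x) (sgn*sgn≡1 k) ⟩
  - (sgn k *ℤ bin N (2 + k)) -ℤ + 1
    ∎
  where
  open ≡-Reasoning
  expand : ∀ s x → (- s) *ℤ (x +ℤ s) ≡ - (s *ℤ x) -ℤ s *ℤ s
  expand = solve-∀

g-shift : ∀ N p → sgn (suc p) *ℤ (bin N (suc p + 1) +ℤ sgn (suc p + 1)) ≡ g N p
g-shift N p = begin
  sgn (suc p) *ℤ (bin N (suc (p + 1)) +ℤ sgn (suc (p + 1)))
    ≡⟨ cong₂ (λ j s → sgn (suc p) *ℤ (bin N j +ℤ s)) (sym (ℕ.+-suc p 1))
             (trans (cong (λ i → sgn (suc i)) (ℕ.+-comm p 1)) (sgn-2+ p)) ⟩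
  sgn (suc p) *ℤ (bin N (p + 2) +ℤ sgn p)
    ≡⟨ cong (λ i → sgn i *ℤ (bin N (p + 2) +ℤ sgn p)) (ℕ.+-comm 1 p) ⟩
  g N p
    ∎
  where open ≡-Reasoning

reassoc-φ : ∀ N x s m →
  x *ℤ bin (s + m + 1) s *ℤ sgn (s + m + 1) *ℤ (bin N (s + m + 2) +ℤ sgn (s + m)) ≡ x *ℤ DoubleSum.φ (g N) s m
reassoc-φ N x s m = assoc x (bin (s + m + 1) s) (sgn (s + m + 1)) (bin N (s + m + 2) +ℤ sgn (s + m))
  where
  assoc : ∀ w x y z → w *ℤ x *ℤ y *ℤ z ≡ w *ℤ (x *ℤ (y *ℤ z))
  assoc = solve-∀

termC1≡doubleSum : ∀ a b → termC1 a b ≡ sgn a *ℤ DoubleSum.doubleSum (g (a + b + 3)) a b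
termC1≡doubleSum a zero    = sym (ℤ.*-zeroʳ (sgn a))
termC1≡doubleSum a (suc B) = trans (sumTo≡∑< B _)
  (trans (∑<-cong (suc B) (λ l → cong (sgn a *ℤ_)
            (trans (sumTo≡∑< a _) (∑<-cong (suc a) (λ r → reassoc-φ N (bin (r + l + 1) r) (a ∸ r) (B ∸ l))))))
         (∑<-distribˡ-* (suc B) (sgn a) (λ l → DoubleSum.innerSum (g N) a l (B ∸ l))))
  where
  N = a + suc B + 3

termC2≡convolution : ∀ a b → let N = a + b + 3 in
  termC2 a b ≡ (+ 2) *ℤ sgn a *ℤ (DoubleSum.convolution (g N) a b +ℤ bin (a + b + 1) a *ℤ (bin N 1 -ℤ + 1))
termC2≡convolution a b =
  cong ((+ 2) *ℤ sgn a *ℤ_) (trans (sumTo≡∑< a f) (cong₂ _+ℤ_ (∑<-cong-< a inside) boundary))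
  where
  N = a + b + 3
  f : ℕ → ℤ
  f r = bin (r + b + 1) r *ℤ sgn (a ∸ r) *ℤ (bin N (a ∸ r + 1) +ℤ sgn (a ∸ r + 1))
  inside : ∀ r → r < a → f r ≡ bin (r + b + 1) r *ℤ g N (a ∸ suc r)
  inside r r<a = begin
    f r
      ≡⟨ cong (λ s → bin (r + b + 1) r *ℤ sgn s *ℤ (bin N (s + 1) +ℤ sgn (s + 1))) (ℕ.+-∸-assoc 1 r<a) ⟩
    bin (r + b + 1) r *ℤ sgn (suc p) *ℤ (bin N (suc p + 1) +ℤ sgn (suc p + 1))
      ≡⟨ ℤ.*-assoc (bin (r + b + 1) r) (sgn (suc p)) _ ⟩
    bin (r + b + 1) r *ℤ (sgn (suc p) *ℤ (bin N (suc p + 1) +ℤ sgn (suc p + 1)))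
      ≡⟨ cong (bin (r + b + 1) r *ℤ_) (g-shift N p) ⟩
    bin (r + b + 1) r *ℤ g N p
      ∎
    where
    open ≡-Reasoning
    p = a ∸ suc r
  boundary : f a ≡ bin (a + b + 1) a *ℤ (bin N 1 -ℤ + 1)
  boundary = trans (cong (λ s → bin (a + b + 1) a *ℤ sgn s *ℤ (bin N (s + 1) +ℤ sgn (s + 1))) (ℕ.n∸n≡0 a))
                   (cong (_*ℤ (bin N 1 -ℤ + 1)) (ℤ.*-identityʳ (bin (a + b + 1) a)))

termC3≡convolution : ∀ a b → termC3 a b ≡ - (sgn a *ℤ DoubleSum.convolution (g (a + b + 3)) a b)
termC3≡convolution zero     b = refl
termC3≡convolution (suc a′) b = begin
  termC3 (suc a′) b
    ≡⟨ trans (sumTo≡∑< a′ _) (∑<-cong (suc a′) (λ m → cong (sgn (a′ ∸ m) *ℤ_)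
         (trans (sumTo≡∑< (a′ ∸ m) _) (∑<-cong (suc (a′ ∸ m)) (λ r → reassoc-φ N (c r) (a′ ∸ m ∸ r) m))))) ⟩
  ∑[ m < suc a′ ] sgn (a′ ∸ m) *ℤ (∑[ r < suc (a′ ∸ m) ] c r *ℤ φ (a′ ∸ m ∸ r) m)
    ≡⟨ ∑<-reverse (suc a′) _ ⟩
  ∑[ n < suc a′ ] sgn (a′ ∸ (a′ ∸ n)) *ℤ (∑[ r < suc (a′ ∸ (a′ ∸ n)) ] c r *ℤ φ (a′ ∸ (a′ ∸ n) ∸ r) (a′ ∸ n))
    ≡⟨ ∑<-cong-< (suc a′) (λ n n<1+a′ → trans
         (cong (λ k → sgn k *ℤ (∑[ r < suc k ] c r *ℤ φ (k ∸ r) (a′ ∸ n))) (ℕ.m∸[m∸n]≡n (ℕ.≤-pred n<1+a′)))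
         (sym (∑<-distribˡ-* (suc n) (sgn n) _))) ⟩
  ∑[ n < suc a′ ] ∑[ r < suc n ] sgn n *ℤ (c r *ℤ φ (n ∸ r) (a′ ∸ n))
    ≡⟨ ∑<-triangle (suc a′) (λ n r → sgn n *ℤ (c r *ℤ φ (n ∸ r) (a′ ∸ n))) ⟩
  ∑[ r < suc a′ ] ∑[ t < suc a′ ∸ r ] sgn (r + t) *ℤ (c r *ℤ φ (r + t ∸ r) (a′ ∸ (r + t)))
    ≡⟨ ∑<-cong-< (suc a′) (λ r r<1+a′ → column r (ℕ.≤-pred r<1+a′)) ⟩
  ∑[ r < suc a′ ] sgn a′ *ℤ (c r *ℤ G (a′ ∸ r))
    ≡⟨ ∑<-distribˡ-* (suc a′) (sgn a′) _ ⟩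
  sgn a′ *ℤ convolution (suc a′) b
    ≡⟨ double-neg (sgn a′) (convolution (suc a′) b) ⟩
  - (sgn (suc a′) *ℤ convolution (suc a′) b)
    ∎
  where
  open ≡-Reasoning
  N = suc a′ + b + 3
  G = g N
  open DoubleSum G
  c : ℕ → ℤ
  c r = bin (r + b + 1) r
  double-neg : ∀ s x → s *ℤ x ≡ - ((- s) *ℤ x)
  double-neg = solve-∀
  split-sign : ∀ σ τ x y → (σ *ℤ τ) *ℤ (x *ℤ y) ≡ (σ *ℤ x) *ℤ (τ *ℤ y)
  split-sign = solve-∀
  merge-sign : ∀ σ x τ y → (σ *ℤ x) *ℤ (τ *ℤ y) ≡ (σ *ℤ τ) *ℤ (x *ℤ y)
  merge-sign = solve-∀
  column : ∀ r → r ≤ a′ →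
    ∑[ t < suc a′ ∸ r ] sgn (r + t) *ℤ (c r *ℤ φ (r + t ∸ r) (a′ ∸ (r + t))) ≡ sgn a′ *ℤ (c r *ℤ G (a′ ∸ r))
  column r r≤a′ = begin
    ∑[ t < suc a′ ∸ r ] sgn (r + t) *ℤ (c r *ℤ φ (r + t ∸ r) (a′ ∸ (r + t)))
      ≡⟨ cong (λ k → ∑[ t < k ] sgn (r + t) *ℤ (c r *ℤ φ (r + t ∸ r) (a′ ∸ (r + t)))) (ℕ.+-∸-assoc 1 r≤a′) ⟩
    ∑[ t < suc p ] sgn (r + t) *ℤ (c r *ℤ φ (r + t ∸ r) (a′ ∸ (r + t)))
      ≡⟨ ∑<-cong (suc p) (λ t → trans
           (cong₂ (λ s k → s *ℤ (c r *ℤ φ k (a′ ∸ (r + t)))) (sgn-+ r t) (ℕ.m+n∸m≡n r t))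
           (trans (cong (λ k → (sgn r *ℤ sgn t) *ℤ (c r *ℤ φ t k)) (sym (ℕ.∸-+-assoc a′ r t)))
                  (split-sign (sgn r) (sgn t) (c r) (φ t (p ∸ t))))) ⟩
    ∑[ t < suc p ] (sgn r *ℤ c r) *ℤ (sgn t *ℤ φ t (p ∸ t))
      ≡⟨ ∑<-distribˡ-* (suc p) (sgn r *ℤ c r) _ ⟩
    (sgn r *ℤ c r) *ℤ (∑[ t < suc p ] sgn t *ℤ φ t (p ∸ t))
      ≡⟨ cong ((sgn r *ℤ c r) *ℤ_) (∑<-alternating-φ p) ⟩
    (sgn r *ℤ c r) *ℤ (sgn p *ℤ G p)
      ≡⟨ merge-sign (sgn r) (c r) (sgn p) (G p) ⟩
    (sgn r *ℤ sgn p) *ℤ (c r *ℤ G p)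
      ≡⟨ cong (_*ℤ (c r *ℤ G p)) (trans (sym (sgn-+ r p)) (cong sgn (ℕ.m+[n∸m]≡n r≤a′))) ⟩
    sgn a′ *ℤ (c r *ℤ G p)
      ∎
    where p = a′ ∸ r

∑<-alternating-tail : ∀ M c → c ≤ 2 + M → sgn M ≡ + 1 →
  ∑[ k < M ] sgn k *ℤ (bin (3 + M) (2 + k) *ℤ bin (suc k) c)
    ≡ + (3 + M) *ℤ bin 0 c -ℤ sgn c -ℤ + (3 + M) *ℤ bin (suc M) c +ℤ bin (2 + M) c
∑<-alternating-tail M c c≤2+M sgnM≡1 = begin
  ∑[ k < M ] sgn k *ℤ (bin N (2 + k) *ℤ bin (suc k) c)
    ≡⟨ ∑<-cong M (λ k → cong (_*ℤ (bin N (2 + k) *ℤ bin (suc k) c)) (sym (sgn-2+ k))) ⟩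
  ∑[ k < M ] f (2 + k)
    ≡⟨ isolate (∑[ k < M ] f (2 + k)) (f 0) (f 1) (f (2 + M)) (f (3 + M))
         (trans (sym (∑<-alternating-predBin (2 + M) c c≤2+M))
                (trans (∑<-suc (3 + M) f) (cong (f 0 +ℤ_) (∑<-suc (2 + M) (λ j → f (suc j)))))) ⟩
  - (f 0 +ℤ f 1 +ℤ f (2 + M) +ℤ f (3 + M))
    ≡⟨ evaluate (cong +_ (nC1≡n N)) (cong +_ ([1+n]Cn≡1+n (2 + M))) (trans (sgn-2+ M) sgnM≡1) (cong +_ (nCn≡1 N)) ⟩
  + N *ℤ bin 0 c -ℤ sgn c -ℤ + N *ℤ bin (suc M) c +ℤ bin (2 + M) c
    ∎
  where
  open ≡-Reasoning
  N = 3 + M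
  f : ℕ → ℤ
  f j = sgn j *ℤ (bin N j *ℤ predBin c j)
  isolate : ∀ x p q r s → + 0 ≡ p +ℤ (q +ℤ (x +ℤ r +ℤ s)) → x ≡ - (p +ℤ q +ℤ r +ℤ s)
  isolate x p q r s 0≡sum =
    trans (move x p q r s) (trans (cong (_-ℤ (p +ℤ q +ℤ r +ℤ s)) (sym 0≡sum)) (ℤ.+-identityˡ _))
    where
    move : ∀ x p q r s → x ≡ p +ℤ (q +ℤ (x +ℤ r +ℤ s)) -ℤ (p +ℤ q +ℤ r +ℤ s)
    move = solve-∀
  simplify : ∀ σ n z u v →
    - (+ 1 *ℤ (+ 1 *ℤ σ) +ℤ - (+ 1) *ℤ (n *ℤ z) +ℤ + 1 *ℤ (n *ℤ u) +ℤ - (+ 1) *ℤ (+ 1 *ℤ v))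
      ≡ n *ℤ z -ℤ σ -ℤ n *ℤ u +ℤ v
  simplify = solve-∀
  evaluate : ∀ {x y s t} → x ≡ + N → y ≡ + N → s ≡ + 1 → t ≡ + 1 →
    - (+ 1 *ℤ (+ 1 *ℤ sgn c) +ℤ - (+ 1) *ℤ (x *ℤ bin 0 c) +ℤ s *ℤ (y *ℤ bin (suc M) c) +ℤ (- s) *ℤ (t *ℤ bin (2 + M) c))
      ≡ + N *ℤ bin 0 c -ℤ sgn c -ℤ + N *ℤ bin (suc M) c +ℤ bin (2 + M) c
  evaluate refl refl refl refl = simplify (sgn c) (+ N) (bin 0 c) (bin (suc M) c) (bin (2 + M) c)

moment-g : ∀ {N} M c → N ≡ 3 + M → c ≤ 2 + M → sgn M ≡ + 1 →
  DoubleSum.moment (g N) M c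
    ≡ sgn c +ℤ bin 0 c -ℤ + N *ℤ bin 0 c +ℤ + N *ℤ bin (suc M) c -ℤ bin (2 + M) c -ℤ bin (suc M) (suc c)
moment-g {N} M c refl c≤2+M sgnM≡1 = begin
  ∑[ k < M ] g N k *ℤ bin (suc k) c
    ≡⟨ ∑<-cong M (λ k → trans (cong (_*ℤ bin (suc k) c) (g-expand N k))
                              (distribute (sgn k) (bin N (2 + k)) (bin (suc k) c))) ⟩
  ∑[ k < M ] - (sgn k *ℤ (bin N (2 + k) *ℤ bin (suc k) c)) +ℤ - bin (suc k) c
    ≡⟨ trans (∑<-distrib-+ M _ _) (cong₂ _+ℤ_ (∑<-distrib-neg M _) (∑<-distrib-neg M _)) ⟩
  - (∑[ k < M ] sgn k *ℤ (bin N (2 + k) *ℤ bin (suc k) c)) -ℤ (∑[ k < M ] bin (suc k) c)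
    ≡⟨ cong₂ (λ x h → - x -ℤ h) (∑<-alternating-tail M c c≤2+M sgnM≡1) hockey ⟩
  - (+ N *ℤ bin 0 c -ℤ sgn c -ℤ + N *ℤ bin (suc M) c +ℤ bin (2 + M) c) -ℤ (bin (suc M) (suc c) -ℤ bin 0 c)
    ≡⟨ rearrange (sgn c) (+ N) (bin 0 c) (bin (suc M) c) (bin (2 + M) c) (bin (suc M) (suc c)) ⟩
  sgn c +ℤ bin 0 c -ℤ + N *ℤ bin 0 c +ℤ + N *ℤ bin (suc M) c -ℤ bin (2 + M) c -ℤ bin (suc M) (suc c)
    ∎
  where
  open ≡-Reasoning
  distribute : ∀ s x y → (- (s *ℤ x) -ℤ + 1) *ℤ y ≡ - (s *ℤ (x *ℤ y)) +ℤ - y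
  distribute = solve-∀
  rearrange : ∀ σ n z u v h → - (n *ℤ z -ℤ σ -ℤ n *ℤ u +ℤ v) -ℤ (h -ℤ z) ≡ σ +ℤ z -ℤ n *ℤ z +ℤ n *ℤ u -ℤ v -ℤ h
  rearrange = solve-∀
  subtract : ∀ z h → h ≡ z +ℤ h -ℤ z
  subtract = solve-∀
  hockey : ∑[ k < M ] bin (suc k) c ≡ bin (suc M) (suc c) -ℤ bin 0 c
  hockey = trans (subtract (bin 0 c) _)
                 (cong (_-ℤ bin 0 c) (trans (sym (∑<-suc M (λ k → bin k c))) (∑<-bin-hockey (suc M) c)))

closedForm-value : ∀ a b → sgn (a + b) ≡ + 1 → let N = a + b + 3 in
  DoubleSum.closedForm (g N) a b +ℤ DoubleSum.convolution (g N) a b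
    +ℤ (+ 2) *ℤ (bin (a + b + 1) a *ℤ (bin N 1 -ℤ + 1))
    ≡ sgn a +ℤ bin N (b + 2)
closedForm-value a b even = begin
  A *ℤ ∑< M G -ℤ moment M (suc b) -ℤ S +ℤ S +ℤ (+ 2) *ℤ (bin (a + b + 1) a *ℤ (bin N 1 -ℤ + 1))
    ≡⟨ cong₂ (λ x y → A *ℤ ∑< M G -ℤ moment M (suc b) -ℤ S +ℤ S +ℤ (+ 2) *ℤ (x *ℤ (y -ℤ + 1)))
             (cong (λ k → bin k a) (ℕ.+-comm M 1)) (cong +_ (nC1≡n N)) ⟩
  A *ℤ ∑< M G -ℤ moment M (suc b) -ℤ S +ℤ S +ℤ (+ 2) *ℤ (A *ℤ (+ N -ℤ + 1))
    ≡⟨ cong₂ (λ x y → A *ℤ x -ℤ y -ℤ S +ℤ S +ℤ (+ 2) *ℤ (A *ℤ (+ N -ℤ + 1)))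
             (trans (∑<-cong M (λ k → sym (ℤ.*-identityʳ (G k)))) (moment-g M 0 N≡3+M z≤n even))
             (moment-g M (suc b) N≡3+M (s≤s (ℕ.m≤n⇒m≤1+n (ℕ.m≤n+m b a))) even) ⟩
  A *ℤ (sgn 0 +ℤ bin 0 0 -ℤ + N *ℤ bin 0 0 +ℤ + N *ℤ bin (suc M) 0 -ℤ bin (2 + M) 0 -ℤ bin (suc M) 1)
    -ℤ (sgn (suc b) +ℤ bin 0 (suc b) -ℤ + N *ℤ bin 0 (suc b) +ℤ + N *ℤ bin (suc M) (suc b)
        -ℤ bin (2 + M) (suc b) -ℤ bin (suc M) (2 + b))
    -ℤ S +ℤ S +ℤ (+ 2) *ℤ (A *ℤ (+ N -ℤ + 1))
    ≡⟨ evaluate (cong -_ (sgn-parity a b even)) (sym A≡) (ℤ.pos-+ M 3)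
                (trans (cong +_ (trans (nC1≡n (suc M)) (ℕ.+-comm 1 M))) (ℤ.pos-+ M 1)) ⟩
  sgn a +ℤ (C₂ +ℤ (A +ℤ H))
    ≡⟨ cong (sgn a +ℤ_) (sym pascal-twice) ⟩
  sgn a +ℤ bin N (b + 2)
    ∎
  where
  open ≡-Reasoning
  M = a + b
  N = a + b + 3
  G = g N
  open DoubleSum G
  A S C₂ H : ℤ
  A = bin (suc M) a
  S = convolution a b
  C₂ = bin (2 + M) (suc b)
  H = bin (suc M) (2 + b)
  N≡3+M : N ≡ 3 + M
  N≡3+M = ℕ.+-comm M 3
  A≡ : A ≡ bin (suc M) (suc b)
  A≡ = bin-sym a (suc b) (ℕ.+-suc a b)
  identity : ∀ σ x m c h s →
    x *ℤ (+ 1 +ℤ + 1 -ℤ (m +ℤ + 3) *ℤ + 1 +ℤ (m +ℤ + 3) *ℤ + 1 -ℤ + 1 -ℤ (m +ℤ + 1))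
      -ℤ ((- σ) +ℤ + 0 -ℤ (m +ℤ + 3) *ℤ + 0 +ℤ (m +ℤ + 3) *ℤ x -ℤ c -ℤ h)
      -ℤ s +ℤ s +ℤ (+ 2) *ℤ (x *ℤ ((m +ℤ + 3) -ℤ + 1))
      ≡ σ +ℤ (c +ℤ (x +ℤ h))
  identity = solve-∀
  evaluate : ∀ {σ′ A′ n n₁} → σ′ ≡ - sgn a → A′ ≡ A → n ≡ + M +ℤ + 3 → n₁ ≡ + M +ℤ + 1 →
    A *ℤ (+ 1 +ℤ + 1 -ℤ n *ℤ + 1 +ℤ n *ℤ + 1 -ℤ + 1 -ℤ n₁)
      -ℤ (σ′ +ℤ + 0 -ℤ n *ℤ + 0 +ℤ n *ℤ A′ -ℤ C₂ -ℤ H)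
      -ℤ S +ℤ S +ℤ (+ 2) *ℤ (A *ℤ (n -ℤ + 1))
      ≡ sgn a +ℤ (C₂ +ℤ (A +ℤ H))
  evaluate refl refl refl refl = identity (sgn a) A (+ M) C₂ H S
  pascal-twice : bin N (b + 2) ≡ C₂ +ℤ (A +ℤ H)
  pascal-twice = begin
    bin N (b + 2)                                  ≡⟨ cong₂ bin N≡3+M (ℕ.+-comm b 2) ⟩
    bin (3 + M) (2 + b)                            ≡⟨ bin-pascal (2 + M) (suc b) ⟩
    C₂ +ℤ bin (2 + M) (2 + b)                      ≡⟨ cong (C₂ +ℤ_) (bin-pascal (suc M) (suc b)) ⟩
    C₂ +ℤ (bin (suc M) (suc b) +ℤ H)               ≡⟨ cong (λ x → C₂ +ℤ (x +ℤ H)) (sym A≡) ⟩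
    C₂ +ℤ (A +ℤ H)                                 ∎

propositionA1 : (a b : ℕ) → 2 ∣ a + b →
    C a b ≡ (+ 1) +ℤ sgn a *ℤ bin (a + b + 3) (b + 2)
propositionA1 a b (divides q a+b≡q*2) = begin
  termC1 a b +ℤ termC2 a b +ℤ termC3 a b
    ≡⟨ cong₂ _+ℤ_ (cong₂ _+ℤ_ (trans (termC1≡doubleSum a b) (cong (σ *ℤ_) (doubleSum≡closedForm a b)))
                              (termC2≡convolution a b))
                  (termC3≡convolution a b) ⟩
  σ *ℤ T +ℤ (+ 2) *ℤ σ *ℤ (S +ℤ B) +ℤ - (σ *ℤ S)
    ≡⟨ collect σ T S B ⟩
  σ *ℤ (T +ℤ S +ℤ (+ 2) *ℤ B)
    ≡⟨ cong (σ *ℤ_) (closedForm-value a b (trans (cong sgn a+b≡q*2) (sgn-even q))) ⟩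
  σ *ℤ (σ +ℤ bin N (b + 2))
    ≡⟨ trans (ℤ.*-distribˡ-+ σ σ (bin N (b + 2))) (cong (_+ℤ σ *ℤ bin N (b + 2)) (sgn*sgn≡1 a)) ⟩
  + 1 +ℤ σ *ℤ bin N (b + 2)
    ∎
  where
  open ≡-Reasoning
  N = a + b + 3
  open DoubleSum (g N)
  σ T S B : ℤ
  σ = sgn a
  T = closedForm a b
  S = convolution a b
  B = bin (a + b + 1) a *ℤ (bin N 1 -ℤ + 1)
  collect : ∀ σ t s x → σ *ℤ t +ℤ (+ 2) *ℤ σ *ℤ (s +ℤ x) +ℤ - (σ *ℤ s) ≡ σ *ℤ (t +ℤ s +ℤ (+ 2) *ℤ x)
  collect = solve-∀
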